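{- Let $q\ge 2$ be a prime power, $m\ge 2$, and let $l$ be an integer with $1\le l\le m-1$. In the polynomial ring $\mathbb{F}_q[y_1,\dots,y_m]$, $$\mathcal{M}_{m,l}\subseteq \big\langle \mathcal{M}_{m,l+1}\cup\{\sigma_l\}\cup E_q[Y]\big\rangle .$$
   Context: $\mathbb{F}_q$ is the finite field with $q$ elements and $\mathbb{F}_q[Y]=\mathbb{F}_q[y_1,\dots,y_m]$. $E_q[Y]=\{y_1^q-y_1,\dots,y_m^q-y_m\}$. For $1\le t\le m$, $\mathcal{M}_{m,t}=\{y_{h_1}y_{h_2}\cdots y_{h_t}\mid 1\le h_1<h_2<\dots<h_t\le m\}$ is the set of products of $t$ distinct variables. $\sigma_l$ denotes the $l$-th elementary symmetric polynomial in $y_1,\dots,y_m$ (the sum of all elements of $\mathcal{M}_{m,l}$). $\langle L\rangle$ is the ideal generated by $L$. -}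

module Defs where

open import Level using (Level; _⊔_)
open import Data.Nat using (ℕ; zero; suc; _≡ᵇ_) renaming (_+_ to _+ℕ_; _^_ to _^ℕ_)
open import Data.Nat.Primality using (Prime)
open import Data.Fin using (Fin)
open import Data.Bool using (Bool; true; false; if_then_else_)
open import Data.Vec using (Vec; []; _∷_; replicate; zipWith; tabulate; count)
open import Data.Vec.Properties using (≡-dec)
open import Data.List using (List; []; _∷_; _++_; map; concatMap; filter)
open import Data.Product using (Σ; ∃; _×_; _,_)
open import Relation.Nullary using (¬_; yes; no)
import Relation.Nullary
import Relation.Nullary.Decidable.Core
open import Relation.Binary.PropositionalEquality using (_≡_)
open import Data.List.Relation.Unary.All using (All)
open import Algebra.Bundles using (CommutativeRing)
import Data.Nat.Properties as ℕP
import Data.Fin as F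

record Field (c ℓ : Level) : Set (Level.suc (c ⊔ ℓ)) where
  field
    commutativeRing : CommutativeRing c ℓ
  open CommutativeRing commutativeRing public
  field
    1≉0     : ¬ (1# ≈ 0#)
    inverse : ∀ x → ¬ (x ≈ 0#) → Σ Carrier λ y → x * y ≈ 1#

HasCard : ∀ {c ℓ} → Field c ℓ → ℕ → Set (c ⊔ ℓ)
HasCard F q =
  Σ (Fin q → Carrier) λ e →
    (∀ i j → e i ≈ e j → i ≡ j) × (∀ x → Σ (Fin q) λ i → e i ≈ x)
  where open Field F

IsPrimePower : ℕ → Set
IsPrimePower q = Σ ℕ λ p → Σ ℕ λ k → Prime p × (q ≡ p ^ℕ suc k)

-- A polynomial is a finite formal sum of terms  a · y^α  (a list of (coefficient, exponent vector));
-- two polynomials are equal (≋) when all their coefficients agree.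
module Poly {c ℓ} (R : CommutativeRing c ℓ) (m : ℕ) where
  open CommutativeRing R

  Mon : Set
  Mon = Vec ℕ m

  Pol : Set c
  Pol = List (Carrier × Mon)

  coeff : Pol → Mon → Carrier
  coeff [] α = 0#
  coeff ((a , β) ∷ p) α with ≡-dec ℕP._≟_ β α
  ... | yes _ = a + coeff p α
  ... | no  _ = coeff p α

  _≋_ : Pol → Pol → Set ℓ
  p ≋ p' = ∀ α → coeff p α ≈ coeff p' α

  zeroP : Pol
  zeroP = []

  oneP : Pol
  oneP = (1# , replicate m 0) ∷ []

  _⊕_ : Pol → Pol → Pol
  p ⊕ p' = p ++ p'

  ⊖_ : Pol → Pol
  ⊖ p = map (λ { (a , β) → (- a , β) }) p

  _⊗_ : Pol → Pol → Pol
  p ⊗ p' = concatMap (λ { (a , β) → map (λ { (b , γ) → (a * b , zipWith _+ℕ_ β γ) }) p' }) p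

  _^P_ : Pol → ℕ → Pol
  p ^P zero = oneP
  p ^P suc n = p ⊗ (p ^P n)

  unitMon : Fin m → Mon
  unitMon i = tabulate (λ j → if ⌊ i F.≟ j ⌋' then 1 else 0)
    where
      ⌊_⌋' : ∀ {A : Set} → Relation.Nullary.Dec A → Bool
      ⌊ yes _ ⌋' = true
      ⌊ no _ ⌋' = false

  var : Fin m → Pol
  var i = (1# , unitMon i) ∷ []

  sumP : List Pol → Pol
  sumP [] = zeroP
  sumP (p ∷ ps) = p ⊕ sumP ps

  -- subsets of {1..m} as characteristic Bool vectors; the monomial y_{h_1}⋯y_{h_t}
  -- with {h_1<⋯<h_t} = S is the monomial with exponent 1 on S and 0 elsewhere.
  subsetMon : Vec Bool m → Pol
  subsetMon S = (1# , Data.Vec.map (λ b → if b then 1 else 0) S) ∷ []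

  size : Vec Bool m → ℕ
  size S = count (λ b → Relation.Nullary.Decidable.Core.T? b) S

  𝓜 : ℕ → Pol → Set c
  𝓜 t g = Σ (Vec Bool m) λ S → (size S ≡ t) × (g ≡ subsetMon S)

  allSubsets : ∀ n → List (Vec Bool n)
  allSubsets zero = [] ∷ []
  allSubsets (suc n) = map (true ∷_) (allSubsets n) ++ map (false ∷_) (allSubsets n)

  σ : ℕ → Pol
  σ l = sumP (map subsetMon (filter (λ S → size S ℕP.≟ l) (allSubsets m)))

  𝓔 : ℕ → Pol → Set c
  𝓔 q g = Σ (Fin m) λ i → g ≡ ((var i ^P q) ⊕ (⊖ var i))

  InIdeal : ∀ {ℓ'} → (Pol → Set ℓ') → Pol → Set (c ⊔ ℓ ⊔ ℓ')
  InIdeal G f = Σ (List (Pol × Pol)) λ cs →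
    All (λ { (_ , g) → G g }) cs × (f ≋ sumP (map (λ { (h , g) → h ⊗ g }) cs))

module Submission where

open import Defs
open import Algebra.Bundles using (CommutativeRing)
open import Data.Bool using (Bool; true; false; if_then_else_; T?)
open import Data.Fin as Fin using (Fin; zero; suc)
open import Data.List as List using (List; []; _∷_; _++_; foldr; filter)
open import Data.List.Properties using (++-assoc; ++-identityʳ; map-++)
open import Data.List.Membership.Propositional using (_∈_)
open import Data.List.Membership.Propositional.Properties
  using (∈-++⁺ˡ; ∈-++⁺ʳ; ∈-map⁺; ∈-map⁻; ∈-filter⁺; ∈-filter⁻)
open import Data.List.Relation.Unary.All as All using (All; []; _∷_)
import Data.List.Relation.Unary.All.Properties as All
open import Data.List.Relation.Unary.AllPairs using ([]; _∷_)
open import Data.List.Relation.Unary.Any using (here; there)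
open import Data.List.Relation.Unary.Unique.Propositional using (Unique)
import Data.List.Relation.Unary.Unique.Propositional.Properties as Unique
open import Data.Nat using (ℕ; zero; suc; _≤_; _∸_; s≤s)
import Data.Nat
import Data.Nat.Properties as ℕ
open import Data.Nat.Tactic.RingSolver using (solve-∀)
open import Data.Product using (Σ; _×_; _,_; map₁; proj₁; proj₂)
open import Data.Sum using (_⊎_; inj₁; inj₂)
open import Data.Vec as Vec using (Vec; []; _∷_; zipWith; replicate; lookup; tabulate; count; _[_]≔_)
open import Data.Vec.Properties
  using ( ∷-injectiveʳ; ≡-dec; zipWith-assoc; zipWith-comm; zipWith-identityˡ; zipWith-identityʳ
        ; map-replicate; lookup-replicate; lookup∘tabulate; tabulate∘lookup; tabulate-cong
        ; lookup∘update; []≔-lookup; []≔-idempotent)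
open import Function using (_∘_)
open import Level using (Level; _⊔_)
open import Relation.Binary.Bundles using (Setoid)
open import Relation.Binary.Structures using (IsEquivalence)
import Relation.Binary.Reasoning.Setoid as SetoidReasoning
open import Relation.Nullary using (¬_; Dec; does; yes; no; contradiction)
open import Relation.Binary.PropositionalEquality as ≡ using (_≡_; _≢_; cong; cong₂)

-- Fix S with |S| = l and write y^S = ∏_{i ∈ S} y_i.  Multiply σ_l by
-- (y^S)^{q-1}.  The summand indexed by S becomes (y^S)^q; every other summand
-- y^T (|T| = l, T ≠ S) contains a variable y_i with i ∈ T ∖ S, so
-- (y^S)^{q-1} y^T is a multiple of y^{S ∪ {i}} ∈ 𝓜_{m,l+1}.  Hence (y^S)^q lies
-- in the ideal.  Finally (y^S)^q ≡ y^S modulo the field equations y_i^q − y_i,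
-- lowering the exponent of one variable of S at a time.

-- Multiplying monomials adds exponent vectors (⊞),
-- raising to the k-th power scales them (⊡).
module ExponentVectors where

  open Data.Nat using (_+_; _*_)

  private
    variable
      n : ℕ

  infixl 6 _⊞_
  infixr 7 _⊡_

  _⊞_ : Vec ℕ n → Vec ℕ n → Vec ℕ n
  _⊞_ = zipWith _+_

  _⊡_ : ℕ → Vec ℕ n → Vec ℕ n
  k ⊡ u = Vec.map (k *_) u

  𝟎 : Vec ℕ n
  𝟎 = replicate _ 0

  unit : Fin n → Vec ℕ n
  unit zero = 1 ∷ 𝟎
  unit (suc i) = 0 ∷ unit i

  χ : Vec Bool n → Vec ℕ n
  χ = Vec.map (λ b → if b then 1 else 0)

  ∣_∣ : Vec Bool n → ℕ
  ∣ S ∣ = count T? S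

  ⊞-identityˡ : (u : Vec ℕ n) → 𝟎 ⊞ u ≡ u
  ⊞-identityˡ = zipWith-identityˡ ℕ.+-identityˡ

  ⊞-assoc : (u v w : Vec ℕ n) → (u ⊞ v) ⊞ w ≡ u ⊞ (v ⊞ w)
  ⊞-assoc = zipWith-assoc ℕ.+-assoc

  ⊞-comm : (u v : Vec ℕ n) → u ⊞ v ≡ v ⊞ u
  ⊞-comm = zipWith-comm ℕ.+-comm

  ⊞-swapʳ : (u v w : Vec ℕ n) → (u ⊞ v) ⊞ w ≡ (u ⊞ w) ⊞ v
  ⊞-swapʳ u v w = begin
    (u ⊞ v) ⊞ w   ≡⟨ ⊞-assoc u v w ⟩
    u ⊞ (v ⊞ w)   ≡⟨ cong (u ⊞_) (⊞-comm v w) ⟩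
    u ⊞ (w ⊞ v)   ≡⟨ ⊞-assoc u w v ⟨
    (u ⊞ w) ⊞ v   ∎
    where open ≡.≡-Reasoning

  ⊡-distrib : ∀ k (u v : Vec ℕ n) → k ⊡ (u ⊞ v) ≡ k ⊡ u ⊞ k ⊡ v
  ⊡-distrib k [] [] = ≡.refl
  ⊡-distrib k (a ∷ u) (b ∷ v) = cong₂ _∷_ (ℕ.*-distribˡ-+ k a b) (⊡-distrib k u v)

  ⊡-𝟎 : ∀ k → k ⊡ 𝟎 ≡ 𝟎 {n}
  ⊡-𝟎 {n} k = ≡.trans (map-replicate (k *_) 0 n) (cong (replicate n) (ℕ.*-zeroʳ k))

  0⊡ : (u : Vec ℕ n) → 0 ⊡ u ≡ 𝟎
  0⊡ [] = ≡.refl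
  0⊡ (a ∷ u) = cong (0 ∷_) (0⊡ u)

  suc⊡ : ∀ k (u : Vec ℕ n) → suc k ⊡ u ≡ u ⊞ k ⊡ u
  suc⊡ k [] = ≡.refl
  suc⊡ k (a ∷ u) = cong (a + k * a ∷_) (suc⊡ k u)

  lookup-unit : (i j : Fin n) → lookup (unit i) j ≡ (if does (i Fin.≟ j) then 1 else 0)
  lookup-unit zero zero = ≡.refl
  lookup-unit zero (suc j) = lookup-replicate j 0
  lookup-unit (suc i) zero = ≡.refl
  lookup-unit (suc i) (suc j) = lookup-unit i j

  support : Vec Bool n → List (Fin n)
  support [] = []
  support (true ∷ S) = zero ∷ List.map suc (support S)
  support (false ∷ S) = List.map suc (support S)

  Σunit : List (Fin n) → Vec ℕ n
  Σunit = foldr (λ i v → unit i ⊞ v) 𝟎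

  Σunit-suc : (is : List (Fin n)) → Σunit (List.map suc is) ≡ 0 ∷ Σunit is
  Σunit-suc [] = ≡.refl
  Σunit-suc (i ∷ is) = cong (unit (suc i) ⊞_) (Σunit-suc is)

  χ-support : (S : Vec Bool n) → χ S ≡ Σunit (support S)
  χ-support [] = ≡.refl
  χ-support (true ∷ S) rewrite Σunit-suc (support S) =
    cong (1 ∷_) (≡.trans (χ-support S) (≡.sym (⊞-identityˡ _)))
  χ-support (false ∷ S) rewrite Σunit-suc (support S) = cong (0 ∷_) (χ-support S)

  χ-insert : (S : Vec Bool n) (i : Fin n) → lookup S i ≡ false →
             χ (S [ i ]≔ true) ≡ χ S ⊞ unit i
  χ-insert (false ∷ S) zero _ = cong (1 ∷_) (≡.sym (zipWith-identityʳ ℕ.+-identityʳ (χ S)))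
  χ-insert (b ∷ S) (suc i) Si≡false =
    cong₂ _∷_ (≡.sym (ℕ.+-identityʳ _)) (χ-insert S i Si≡false)

  χ-remove : (T : Vec Bool n) (i : Fin n) → lookup T i ≡ true →
             χ T ≡ χ (T [ i ]≔ false) ⊞ unit i
  χ-remove T i Ti≡true = begin
    χ T                              ≡⟨ cong χ T≡reinsert ⟩
    χ ((T [ i ]≔ false) [ i ]≔ true)  ≡⟨ χ-insert (T [ i ]≔ false) i (lookup∘update i T false) ⟩
    χ (T [ i ]≔ false) ⊞ unit i       ∎
    where
    open ≡.≡-Reasoning
    T≡reinsert : T ≡ (T [ i ]≔ false) [ i ]≔ true
    T≡reinsert = begin
      T                               ≡⟨ []≔-lookup T i ⟨
      T [ i ]≔ lookup T i              ≡⟨ cong (T [ i ]≔_) Ti≡true ⟩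
      T [ i ]≔ true                    ≡⟨ []≔-idempotent T i ⟨
      (T [ i ]≔ false) [ i ]≔ true     ∎

  size-insert : (S : Vec Bool n) (i : Fin n) → lookup S i ≡ false →
                ∣ S [ i ]≔ true ∣ ≡ suc ∣ S ∣
  size-insert (false ∷ S) zero _ = ≡.refl
  size-insert (true ∷ S) (suc i) Si≡false = cong suc (size-insert S i Si≡false)
  size-insert (false ∷ S) (suc i) Si≡false = size-insert S i Si≡false

  new-element : (S T : Vec Bool n) → ∣ S ∣ ≤ ∣ T ∣ → T ≢ S →
                Σ (Fin n) λ i → lookup T i ≡ true × lookup S i ≡ false
  new-element [] [] _ T≢S = contradiction ≡.refl T≢S
  new-element (false ∷ S) (true ∷ T) _ _ = zero , ≡.refl , ≡.refl
  new-element (true ∷ S) (true ∷ T) (s≤s ∣S∣≤∣T∣) T≢S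
    with new-element S T ∣S∣≤∣T∣ (T≢S ∘ cong (true ∷_))
  ... | i , Ti , Si = suc i , Ti , Si
  new-element (false ∷ S) (false ∷ T) ∣S∣≤∣T∣ T≢S
    with new-element S T ∣S∣≤∣T∣ (T≢S ∘ cong (false ∷_))
  ... | i , Ti , Si = suc i , Ti , Si
  new-element (true ∷ S) (false ∷ T) ∣S∣<∣T∣ _
    with new-element S T (ℕ.<⇒≤ ∣S∣<∣T∣) (λ T≡S → ℕ.<-irrefl (cong ∣_∣ (≡.sym T≡S)) ∣S∣<∣T∣)
  ... | i , Ti , Si = suc i , Ti , Si

  exponent-regroup : ∀ k (s t u : Vec ℕ n) → suc k ⊡ s ⊞ (t ⊞ u) ≡ (k ⊡ s ⊞ t) ⊞ (s ⊞ u)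
  exponent-regroup k [] [] [] = ≡.refl
  exponent-regroup k (a ∷ s) (b ∷ t) (c ∷ u) =
    cong₂ _∷_ (regroup k a b c) (exponent-regroup k s t u)
    where
    regroup : ∀ k a b c → (a + k * a) + (b + c) ≡ (k * a + b) + (a + c)
    regroup = solve-∀

  exponent-power : ∀ k (s : Vec ℕ n) → suc k ⊡ s ⊞ s ≡ suc (suc k) ⊡ s
  exponent-power k [] = ≡.refl
  exponent-power k (a ∷ s) = cong₂ _∷_ (ℕ.+-comm (suc k * a) a) (exponent-power k s)

open ExponentVectors

lookup-tabulated : ∀ {n} (v : Vec ℕ n) {f : Fin n → ℕ} → v ≡ tabulate f → ∀ j → lookup v j ≡ f j
lookup-tabulated v {f} ≡.refl j = lookup∘tabulate f j

module Polynomials {c ℓ} (R : CommutativeRing c ℓ) (m : ℕ) where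

  open CommutativeRing R
  open Poly R m
  open import Algebra.Properties.Ring ring
    using (-0#≈0#; -‿+-comm; -‿distribˡ-*; -‿anti-homo-+; -‿involutive; xyx⁻¹≈y; ⁻¹-anti-homo‿-)
  module ≈-Reasoning = SetoidReasoning setoid

  coeff-⊕ : ∀ p p' α → coeff (p ⊕ p') α ≈ coeff p α + coeff p' α
  coeff-⊕ [] p' α = sym (+-identityˡ _)
  coeff-⊕ ((a , β) ∷ p) p' α with ≡-dec ℕ._≟_ β α
  ... | yes _ = trans (+-congˡ (coeff-⊕ p p' α)) (sym (+-assoc _ _ _))
  ... | no _  = coeff-⊕ p p' α

  coeff-⊖ : ∀ p α → coeff (⊖ p) α ≈ - coeff p α
  coeff-⊖ [] α = sym -0#≈0#
  coeff-⊖ ((a , β) ∷ p) α with ≡-dec ℕ._≟_ β α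
  ... | yes _ = trans (+-congˡ (coeff-⊖ p α)) (-‿+-comm a (coeff p α))
  ... | no _  = coeff-⊖ p α

  coeff-⊕⊖ : ∀ p p' α → coeff (p ⊕ (⊖ p')) α ≈ coeff p α + - coeff p' α
  coeff-⊕⊖ p p' α = trans (coeff-⊕ p (⊖ p') α) (+-congˡ (coeff-⊖ p' α))

  telescope : ∀ a b c → (a + - b) + (b + - c) ≈ a + - c
  telescope a b c = begin
    (a + - b) + (b + - c)   ≈⟨ +-assoc a (- b) (b + - c) ⟩
    a + (- b + (b + - c))   ≈⟨ +-congˡ (+-assoc (- b) b (- c)) ⟨
    a + ((- b + b) + - c)   ≈⟨ +-congˡ (+-congʳ (-‿inverseˡ b)) ⟩
    a + (0# + - c)          ≈⟨ +-congˡ (+-identityˡ (- c)) ⟩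
    a + - c                 ∎
    where open ≈-Reasoning

  cancel : ∀ a b → a + - (a + - b) ≈ b
  cancel a b = begin
    a + - (a + - b)         ≈⟨ +-congˡ (-‿anti-homo-+ a (- b)) ⟩
    a + (- - b + - a)       ≈⟨ +-congˡ (+-congʳ (-‿involutive b)) ⟩
    a + (b + - a)           ≈⟨ +-assoc a b (- a) ⟨
    a + b + - a             ≈⟨ xyx⁻¹≈y a b ⟩
    b                       ∎
    where open ≈-Reasoning

  -- Equality of all coefficients (the relation ≋), packaged as a record: unlike
  -- the function type p ≋ p', the record type determines p and p', so Agda
  -- can infer them when lemmas about it are combined.
  record _≈ₚ_ (p p' : Pol) : Set ℓ where
    constructor coeffwise
    field same-coeff : p ≋ p'

  open _≈ₚ_ public

  infix 4 _≈ₚ_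

  ≈ₚ-isEquivalence : IsEquivalence _≈ₚ_
  ≈ₚ-isEquivalence = record
    { refl  = coeffwise λ α → refl
    ; sym   = λ p≈p' → coeffwise λ α → sym (same-coeff p≈p' α)
    ; trans = λ p≈p' p'≈p'' → coeffwise λ α → trans (same-coeff p≈p' α) (same-coeff p'≈p'' α)
    }

  ≈ₚ-setoid : Setoid c ℓ
  ≈ₚ-setoid = record { isEquivalence = ≈ₚ-isEquivalence }

  open IsEquivalence ≈ₚ-isEquivalence public
    using () renaming (refl to ≈ₚ-refl; sym to ≈ₚ-sym; trans to ≈ₚ-trans; reflexive to ≈ₚ-reflexive)

  module ≈ₚ-Reasoning = SetoidReasoning ≈ₚ-setoid

  term-cong : ∀ {a b β β' p p'} → a ≈ b → β ≡ β' → p ≈ₚ p' → (a , β) ∷ p ≈ₚ (b , β') ∷ p'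
  term-cong {a} {b} {β} {p = p} {p'} a≈b ≡.refl (coeffwise p≋p') = coeffwise step
    where
    step : ∀ α → coeff ((a , β) ∷ p) α ≈ coeff ((b , β) ∷ p') α
    step α with ≡-dec ℕ._≟_ β α
    ... | yes _ = +-cong a≈b (p≋p' α)
    ... | no _  = p≋p' α

  ⊕-cong : ∀ {p p' r r'} → p ≈ₚ p' → r ≈ₚ r' → p ⊕ r ≈ₚ p' ⊕ r'
  ⊕-cong {p} {p'} {r} {r'} (coeffwise p≋p') (coeffwise r≋r') = coeffwise λ α → begin
    coeff (p ⊕ r) α            ≈⟨ coeff-⊕ p r α ⟩
    coeff p α + coeff r α      ≈⟨ +-cong (p≋p' α) (r≋r' α) ⟩
    coeff p' α + coeff r' α    ≈⟨ coeff-⊕ p' r' α ⟨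
    coeff (p' ⊕ r') α          ∎
    where open ≈-Reasoning

  ⊖-cong : ∀ {p p'} → p ≈ₚ p' → ⊖ p ≈ₚ ⊖ p'
  ⊖-cong {p} {p'} (coeffwise p≋p') = coeffwise λ α →
    trans (coeff-⊖ p α) (trans (-‿cong (p≋p' α)) (sym (coeff-⊖ p' α)))

  ⊕⊖-self : ∀ f → [] ≈ₚ f ⊕ (⊖ f)
  ⊕⊖-self f = coeffwise λ α → sym (trans (coeff-⊕⊖ f f α) (-‿inverseʳ (coeff f α)))

  ⊖-⊕⊖ : ∀ f g → ⊖ (f ⊕ (⊖ g)) ≈ₚ g ⊕ (⊖ f)
  ⊖-⊕⊖ f g = coeffwise λ α → begin
    coeff (⊖ (f ⊕ (⊖ g))) α           ≈⟨ coeff-⊖ (f ⊕ (⊖ g)) α ⟩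
    - coeff (f ⊕ (⊖ g)) α             ≈⟨ -‿cong (coeff-⊕⊖ f g α) ⟩
    - (coeff f α + - coeff g α)       ≈⟨ ⁻¹-anti-homo‿- (coeff f α) (coeff g α) ⟩
    coeff g α + - coeff f α           ≈⟨ coeff-⊕⊖ g f α ⟨
    coeff (g ⊕ (⊖ f)) α               ∎
    where open ≈-Reasoning

  ⊕⊖-telescope : ∀ f g h → (f ⊕ (⊖ g)) ⊕ (g ⊕ (⊖ h)) ≈ₚ f ⊕ (⊖ h)
  ⊕⊖-telescope f g h = coeffwise λ α → begin
    coeff ((f ⊕ (⊖ g)) ⊕ (g ⊕ (⊖ h))) α                     ≈⟨ coeff-⊕ (f ⊕ (⊖ g)) (g ⊕ (⊖ h)) α ⟩
    coeff (f ⊕ (⊖ g)) α + coeff (g ⊕ (⊖ h)) α               ≈⟨ +-cong (coeff-⊕⊖ f g α) (coeff-⊕⊖ g h α) ⟩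
    (coeff f α + - coeff g α) + (coeff g α + - coeff h α)   ≈⟨ telescope _ _ _ ⟩
    coeff f α + - coeff h α                                 ≈⟨ coeff-⊕⊖ f h α ⟨
    coeff (f ⊕ (⊖ h)) α                                     ∎
    where open ≈-Reasoning

  ⊕⊖-cancel : ∀ f g → f ⊕ (⊖ (f ⊕ (⊖ g))) ≈ₚ g
  ⊕⊖-cancel f g = coeffwise λ α → begin
    coeff (f ⊕ (⊖ (f ⊕ (⊖ g)))) α            ≈⟨ coeff-⊕⊖ f (f ⊕ (⊖ g)) α ⟩
    coeff f α + - coeff (f ⊕ (⊖ g)) α        ≈⟨ +-congˡ (-‿cong (coeff-⊕⊖ f g α)) ⟩
    coeff f α + - (coeff f α + - coeff g α)  ≈⟨ cancel _ _ ⟩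
    coeff g α                                ∎
    where open ≈-Reasoning

  ⊕⊖-isolate : ∀ f r → r ≈ₚ (f ⊕ r) ⊕ (⊖ f)
  ⊕⊖-isolate f r = coeffwise λ α → begin
    coeff r α                                  ≈⟨ xyx⁻¹≈y (coeff f α) (coeff r α) ⟨
    coeff f α + coeff r α + - coeff f α        ≈⟨ +-congʳ (coeff-⊕ f r α) ⟨
    coeff (f ⊕ r) α + - coeff f α              ≈⟨ coeff-⊕⊖ (f ⊕ r) f α ⟨
    coeff ((f ⊕ r) ⊕ (⊖ f)) α                  ∎
    where open ≈-Reasoning

  ⊖-⊕ : ∀ p p' → ⊖ (p ⊕ p') ≡ (⊖ p) ⊕ (⊖ p')
  ⊖-⊕ p p' = map-++ _ p p'

  sumP-++ : ∀ ps ps' → sumP (ps ++ ps') ≡ sumP ps ⊕ sumP ps'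
  sumP-++ [] ps' = ≡.refl
  sumP-++ (p ∷ ps) ps' = ≡.trans (cong (p ⊕_) (sumP-++ ps ps')) (≡.sym (++-assoc p _ _))

  ⊗-∷ : ∀ t h g → (t ∷ h) ⊗ g ≡ ((t ∷ []) ⊗ g) ⊕ (h ⊗ g)
  ⊗-∷ t h g = cong (_⊕ (h ⊗ g)) (≡.sym (++-identityʳ _))

  neg-term-⊗ : ∀ a β g → ((- a , β) ∷ []) ⊗ g ≈ₚ ⊖ (((a , β) ∷ []) ⊗ g)
  neg-term-⊗ a β [] = ≈ₚ-refl
  neg-term-⊗ a β ((b , γ) ∷ g) = term-cong (sym (-‿distribˡ-* a b)) ≡.refl (neg-term-⊗ a β g)

  ⊖-⊗ : ∀ h g → (⊖ h) ⊗ g ≈ₚ ⊖ (h ⊗ g)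
  ⊖-⊗ [] g = ≈ₚ-refl
  ⊖-⊗ ((a , β) ∷ h) g = begin
    (⊖ ((a , β) ∷ h)) ⊗ g                       ≡⟨ ⊗-∷ (- a , β) (⊖ h) g ⟩
    (((- a , β) ∷ []) ⊗ g) ⊕ ((⊖ h) ⊗ g)        ≈⟨ ⊕-cong (neg-term-⊗ a β g) (⊖-⊗ h g) ⟩
    (⊖ (((a , β) ∷ []) ⊗ g)) ⊕ (⊖ (h ⊗ g))      ≡⟨ ⊖-⊕ (((a , β) ∷ []) ⊗ g) (h ⊗ g) ⟨
    ⊖ ((((a , β) ∷ []) ⊗ g) ⊕ (h ⊗ g))           ≡⟨ cong ⊖_ (⊗-∷ (a , β) h g) ⟨
    ⊖ (((a , β) ∷ h) ⊗ g)                       ∎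
    where open ≈ₚ-Reasoning

  mono : Mon → Pol
  mono β = (1# , β) ∷ []

  mono-⊗ : ∀ β γ → mono β ⊗ mono γ ≈ₚ mono (β ⊞ γ)
  mono-⊗ β γ = term-cong (*-identityˡ 1#) ≡.refl ≈ₚ-refl

  mono-⊗-sum : ∀ {A : Set} β (f : A → Mon) xs →
               mono β ⊗ sumP (List.map (λ x → mono (f x)) xs) ≈ₚ sumP (List.map (λ x → mono (β ⊞ f x)) xs)
  mono-⊗-sum β f [] = ≈ₚ-refl
  mono-⊗-sum β f (x ∷ xs) = term-cong (*-identityˡ 1#) ≡.refl (mono-⊗-sum β f xs)

  -- Its
  -- entries are computed by a helper local to unitMon; abstracting over i ≟ j
  -- together with the entry read off the tabulation lets that helper reduce.
  unitMon≡unit : ∀ i → unitMon i ≡ unit i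
  unitMon≡unit i = ≡.trans (≡.sym (tabulate∘lookup (unitMon i)))
    (≡.trans (tabulate-cong (λ j → ≡.trans (lookup-unitMon j) (≡.sym (lookup-unit i j))))
             (tabulate∘lookup (unit i)))
    where
    lookup-unitMon : ∀ j → lookup (unitMon i) j ≡ (if does (i Fin.≟ j) then 1 else 0)
    lookup-unitMon j with i Fin.≟ j | lookup-tabulated (unitMon i) ≡.refl j
    ... | yes _ | entry = entry
    ... | no _  | entry = entry

  -- the coefficient 1·1·…·1 (n factors) that ^P produces for y_i^n
  powerCoeff : ℕ → Carrier
  powerCoeff zero = 1#
  powerCoeff (suc n) = 1# * powerCoeff n

  powerCoeff≈1 : ∀ n → powerCoeff n ≈ 1#
  powerCoeff≈1 zero = refl
  powerCoeff≈1 (suc n) = trans (*-identityˡ _) (powerCoeff≈1 n)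

  var-^P : ∀ i n → var i ^P n ≡ (powerCoeff n , n ⊡ unit i) ∷ []
  var-^P i zero = cong (λ v → (1# , v) ∷ []) (≡.sym (0⊡ (unit i)))
  var-^P i (suc n) rewrite var-^P i n =
    cong (λ v → (1# * powerCoeff n , v) ∷ [])
      (≡.trans (cong (_⊞ n ⊡ unit i) (unitMon≡unit i)) (≡.sym (suc⊡ n (unit i))))

  mono-⊗-field-equation : ∀ β i q →
    mono β ⊗ ((var i ^P q) ⊕ (⊖ var i)) ≈ₚ mono (β ⊞ q ⊡ unit i) ⊕ (⊖ mono (β ⊞ unit i))
  mono-⊗-field-equation β i q rewrite var-^P i q =
    term-cong (trans (*-identityˡ _) (powerCoeff≈1 q)) ≡.refl
      (term-cong (*-identityˡ (- 1#)) (cong (β ⊞_) (unitMon≡unit i)) ≈ₚ-refl)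

  module Ideal {ℓ'} (G : Pol → Set ℓ') where

    ⟨G⟩ : Pol → Set (c ⊔ ℓ ⊔ ℓ')
    ⟨G⟩ = InIdeal G

    cofactor-product : Pol × Pol → Pol
    cofactor-product (h , g) = h ⊗ g

    expresses : ∀ {f} (f∈⟨G⟩ : ⟨G⟩ f) → f ≈ₚ sumP (List.map cofactor-product (proj₁ f∈⟨G⟩))
    expresses (_ , _ , f≋Σ) = coeffwise f≋Σ

    ⟨G⟩-resp-≈ₚ : ∀ {f f'} → f ≈ₚ f' → ⟨G⟩ f → ⟨G⟩ f'
    ⟨G⟩-resp-≈ₚ (coeffwise f≋f') (cs , gens , f≋Σ) = cs , gens , λ α → trans (sym (f≋f' α)) (f≋Σ α)

    0∈⟨G⟩ : ⟨G⟩ []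
    0∈⟨G⟩ = [] , [] , λ α → refl

    generator-multiple : ∀ {g} → G g → ∀ h → ⟨G⟩ (h ⊗ g)
    generator-multiple {g} g∈G h =
      (h , g) ∷ [] , g∈G ∷ [] , same-coeff (≈ₚ-reflexive (≡.sym (++-identityʳ (h ⊗ g))))

    ⟨G⟩-⊕ : ∀ {f f'} → ⟨G⟩ f → ⟨G⟩ f' → ⟨G⟩ (f ⊕ f')
    ⟨G⟩-⊕ {f} {f'} f∈@(cs , gens , _) f'∈@(cs' , gens' , _) =
      cs ++ cs' , All.++⁺ gens gens' , same-coeff (begin
        f ⊕ f'                                              ≈⟨ ⊕-cong (expresses {f} f∈) (expresses {f'} f'∈) ⟩
        sumP (List.map cofactor-product cs) ⊕ sumP (List.map cofactor-product cs')
                                                            ≡⟨ sumP-++ (List.map cofactor-product cs) _ ⟨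
        sumP (List.map cofactor-product cs ++ List.map cofactor-product cs')
                                                            ≡⟨ cong sumP (map-++ cofactor-product cs cs') ⟨
        sumP (List.map cofactor-product (cs ++ cs'))        ∎)
      where open ≈ₚ-Reasoning

    ⟨G⟩-⊖ : ∀ {f} → ⟨G⟩ f → ⟨G⟩ (⊖ f)
    ⟨G⟩-⊖ {f} f∈@(cs , gens , _) =
      List.map negate-cofactor cs , All.map⁺ gens ,
      same-coeff (≈ₚ-trans (⊖-cong (expresses {f} f∈)) (≈ₚ-sym (sum-negated cs)))
      where
      negate-cofactor : Pol × Pol → Pol × Pol
      negate-cofactor = map₁ ⊖_
      sum-negated : ∀ ds → sumP (List.map cofactor-product (List.map negate-cofactor ds))
                           ≈ₚ ⊖ sumP (List.map cofactor-product ds)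
      sum-negated [] = ≈ₚ-refl
      sum-negated ((h , g) ∷ ds) = ≈ₚ-trans (⊕-cong (⊖-⊗ h g) (sum-negated ds))
                                            (≈ₚ-reflexive (≡.sym (⊖-⊕ (h ⊗ g) _)))

    ⟨G⟩-sum : ∀ {A : Set} (φ : A → Pol) xs → (∀ x → x ∈ xs → ⟨G⟩ (φ x)) → ⟨G⟩ (sumP (List.map φ xs))
    ⟨G⟩-sum φ [] _ = 0∈⟨G⟩
    ⟨G⟩-sum φ (x ∷ xs) φ∈⟨G⟩ =
      ⟨G⟩-⊕ {φ x} (φ∈⟨G⟩ x (here ≡.refl)) (⟨G⟩-sum φ xs (λ y y∈xs → φ∈⟨G⟩ y (there y∈xs)))

    infix 4 _∼_
    _∼_ : Pol → Pol → Set (c ⊔ ℓ ⊔ ℓ')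
    f ∼ g = ⟨G⟩ (f ⊕ (⊖ g))

    ∼-refl : ∀ {f} → f ∼ f
    ∼-refl {f} = ⟨G⟩-resp-≈ₚ (⊕⊖-self f) 0∈⟨G⟩

    ∼-sym : ∀ {f g} → f ∼ g → g ∼ f
    ∼-sym {f} {g} f∼g = ⟨G⟩-resp-≈ₚ (⊖-⊕⊖ f g) (⟨G⟩-⊖ {f ⊕ (⊖ g)} f∼g)

    ∼-trans : ∀ {f g h} → f ∼ g → g ∼ h → f ∼ h
    ∼-trans {f} {g} {h} f∼g g∼h = ⟨G⟩-resp-≈ₚ (⊕⊖-telescope f g h) (⟨G⟩-⊕ {f ⊕ (⊖ g)} f∼g g∼h)

    ∼-setoid : Setoid c (c ⊔ ℓ ⊔ ℓ')
    ∼-setoid = record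
      { _≈_ = _∼_
      ; isEquivalence = record
        { refl  = λ {f} → ∼-refl {f}
        ; sym   = λ {f} {g} → ∼-sym {f} {g}
        ; trans = λ {f} {g} {h} → ∼-trans {f} {g} {h}
        }
      }

    module ∼-Reasoning = SetoidReasoning ∼-setoid

    ⟨G⟩-resp-∼ : ∀ {f g} → ⟨G⟩ f → f ∼ g → ⟨G⟩ g
    ⟨G⟩-resp-∼ {f} {g} f∈⟨G⟩ f∼g =
      ⟨G⟩-resp-≈ₚ (⊕⊖-cancel f g) (⟨G⟩-⊕ {f} f∈⟨G⟩ (⟨G⟩-⊖ {f ⊕ (⊖ g)} f∼g))

    sum-isolate : ∀ {A : Set} (φ : A → Pol) {xs x} → Unique xs → x ∈ xs →
                  (∀ y → y ∈ xs → y ≢ x → ⟨G⟩ (φ y)) → sumP (List.map φ xs) ∼ φ x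
    sum-isolate φ {x ∷ xs} (x∉xs ∷ _) (here ≡.refl) others =
      ⟨G⟩-resp-≈ₚ (⊕⊖-isolate (φ x) (sumP (List.map φ xs)))
        (⟨G⟩-sum φ xs λ y y∈xs → others y (there y∈xs) (λ y≡x → All.lookup x∉xs y∈xs (≡.sym y≡x)))
    sum-isolate φ {y ∷ xs} {x} (y∉xs ∷ xs-unique) (there x∈xs) others =
      ≡.subst ⟨G⟩ (≡.sym (++-assoc (φ y) (sumP (List.map φ xs)) (⊖ φ x)))
        (⟨G⟩-⊕ {φ y} (others y (here ≡.refl) (All.lookup y∉xs x∈xs))
          (sum-isolate φ xs-unique x∈xs (λ z z∈xs → others z (there z∈xs))))

  module FieldEquations {ℓ'} (G : Pol → Set ℓ') (q : ℕ) (𝓔⊆G : ∀ {h} → 𝓔 q h → G h) where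

    open Ideal G

    field-equation : ∀ β i → mono (β ⊞ q ⊡ unit i) ∼ mono (β ⊞ unit i)
    field-equation β i =
      ⟨G⟩-resp-≈ₚ (mono-⊗-field-equation β i q) (generator-multiple (𝓔⊆G (i , ≡.refl)) (mono β))

    power-reduction : ∀ γ is → mono (γ ⊞ q ⊡ Σunit is) ∼ mono (γ ⊞ Σunit is)
    power-reduction γ [] = begin
      mono (γ ⊞ q ⊡ 𝟎)   ≡⟨ cong (λ v → mono (γ ⊞ v)) (⊡-𝟎 q) ⟩
      mono (γ ⊞ 𝟎)       ∎
      where open ∼-Reasoning
    power-reduction γ (i ∷ is) = begin
      mono (γ ⊞ q ⊡ (unit i ⊞ r))         ≡⟨ cong (λ v → mono (γ ⊞ v)) (⊡-distrib q (unit i) r) ⟩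
      mono (γ ⊞ (q ⊡ unit i ⊞ q ⊡ r))     ≡⟨ cong mono (⊞-assoc γ (q ⊡ unit i) (q ⊡ r)) ⟨
      mono (γ ⊞ q ⊡ unit i ⊞ q ⊡ r)       ≡⟨ cong mono (⊞-swapʳ γ (q ⊡ unit i) (q ⊡ r)) ⟩
      mono (γ ⊞ q ⊡ r ⊞ q ⊡ unit i)       ≈⟨ field-equation (γ ⊞ q ⊡ r) i ⟩
      mono (γ ⊞ q ⊡ r ⊞ unit i)           ≡⟨ cong mono (⊞-swapʳ γ (q ⊡ r) (unit i)) ⟩
      mono (γ ⊞ unit i ⊞ q ⊡ r)           ≈⟨ power-reduction (γ ⊞ unit i) is ⟩
      mono (γ ⊞ unit i ⊞ r)               ≡⟨ cong mono (⊞-assoc γ (unit i) r) ⟩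
      mono (γ ⊞ (unit i ⊞ r))             ∎
      where
      open ∼-Reasoning
      r : Vec ℕ m
      r = Σunit is

    subset-power-reduction : ∀ S → mono (q ⊡ χ S) ∼ subsetMon S
    subset-power-reduction S = begin
      mono (q ⊡ χ S)                     ≡⟨ cong (λ v → mono (q ⊡ v)) (χ-support S) ⟩
      mono (q ⊡ Σunit (support S))       ≡⟨ cong mono (⊞-identityˡ _) ⟨
      mono (𝟎 ⊞ q ⊡ Σunit (support S))   ≈⟨ power-reduction 𝟎 (support S) ⟩
      mono (𝟎 ⊞ Σunit (support S))       ≡⟨ cong mono (⊞-identityˡ _) ⟩
      mono (Σunit (support S))           ≡⟨ cong mono (χ-support S) ⟨
      mono (χ S)                         ∎
      where open ∼-Reasoning

  allSubsets-complete : ∀ n (S : Vec Bool n) → S ∈ allSubsets n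
  allSubsets-complete zero [] = here ≡.refl
  allSubsets-complete (suc n) (true ∷ S) = ∈-++⁺ˡ (∈-map⁺ (true ∷_) (allSubsets-complete n S))
  allSubsets-complete (suc n) (false ∷ S) =
    ∈-++⁺ʳ (List.map (true ∷_) (allSubsets n)) (∈-map⁺ (false ∷_) (allSubsets-complete n S))

  allSubsets-unique : ∀ n → Unique (allSubsets n)
  allSubsets-unique zero = [] ∷ []
  allSubsets-unique (suc n) =
    Unique.++⁺ (Unique.map⁺ ∷-injectiveʳ (allSubsets-unique n))
               (Unique.map⁺ ∷-injectiveʳ (allSubsets-unique n))
               different-heads
    where
    different-heads : ∀ {S} → ¬ (S ∈ List.map (true ∷_) (allSubsets n)
                               × S ∈ List.map (false ∷_) (allSubsets n))
    different-heads (S∈true , S∈false) with ∈-map⁻ (true ∷_) S∈true | ∈-map⁻ (false ∷_) S∈false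
    ... | _ , _ , ≡.refl | _ , _ , ()

  -- Multiplying σ_l by (∏_{i ∈ S} y_i)^{k+1} for |S| = l isolates the term of S:
  -- every other summand is a multiple of a product of l + 1 distinct variables.
  module ElementarySymmetric {ℓ'} (G : Pol → Set ℓ') (l k : ℕ)
         (𝓜⊆G : ∀ {h} → 𝓜 (suc l) h → G h) (σ∈G : G (σ l)) where

    open Ideal G

    size-l? : (T : Vec Bool m) → Dec (size T ≡ l)
    size-l? T = size T ℕ.≟ l

    subsets-of-size : List (Vec Bool m)
    subsets-of-size = filter size-l? (allSubsets m)

    -- for |T| = |S| = l and T ≠ S, pick i ∈ T ∖ S: then y^{(k+1)S} y^T is
    -- y^{kS} y^{T ∖ i} times the generator y^{S ∪ i} ∈ 𝓜_{l+1}
    other-summand : ∀ {S T} → size S ≡ l → size T ≡ l → T ≢ S → ⟨G⟩ (mono (suc k ⊡ χ S ⊞ χ T))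
    other-summand {S} {T} ∣S∣≡l ∣T∣≡l T≢S
      with new-element S T (ℕ.≤-reflexive (≡.trans ∣S∣≡l (≡.sym ∣T∣≡l))) T≢S
    ... | i , Ti≡true , Si≡false =
      ⟨G⟩-resp-≈ₚ (≈ₚ-trans (mono-⊗ _ _) (≈ₚ-reflexive (cong mono exponents)))
        (generator-multiple (𝓜⊆G (S∪i , ∣S∪i∣≡l+1 , ≡.refl)) (mono (k ⊡ χ S ⊞ χ T∖i)))
      where
      S∪i T∖i : Vec Bool m
      S∪i = S [ i ]≔ true
      T∖i = T [ i ]≔ false
      ∣S∪i∣≡l+1 : size S∪i ≡ suc l
      ∣S∪i∣≡l+1 = ≡.trans (size-insert S i Si≡false) (cong suc ∣S∣≡l)
      exponents : k ⊡ χ S ⊞ χ T∖i ⊞ χ S∪i ≡ suc k ⊡ χ S ⊞ χ T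
      exponents = begin
        k ⊡ χ S ⊞ χ T∖i ⊞ χ S∪i           ≡⟨ cong (k ⊡ χ S ⊞ χ T∖i ⊞_) (χ-insert S i Si≡false) ⟩
        k ⊡ χ S ⊞ χ T∖i ⊞ (χ S ⊞ unit i)  ≡⟨ exponent-regroup k (χ S) (χ T∖i) (unit i) ⟨
        suc k ⊡ χ S ⊞ (χ T∖i ⊞ unit i)    ≡⟨ cong (suc k ⊡ χ S ⊞_) (χ-remove T i Ti≡true) ⟨
        suc k ⊡ χ S ⊞ χ T                 ∎
        where open ≡.≡-Reasoning

    σ-multiple : ∀ S → size S ≡ l → ⟨G⟩ (mono (suc (suc k) ⊡ χ S))
    σ-multiple S ∣S∣≡l = ⟨G⟩-resp-∼ {shifted-σ} shifted-σ∈⟨G⟩ (begin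
      shifted-σ                  ≈⟨ sum-isolate shifted-term unique S∈subsets others ⟩
      mono (cofactor ⊞ χ S)      ≡⟨ cong mono (exponent-power k (χ S)) ⟩
      mono (suc (suc k) ⊡ χ S)   ∎)
      where
      open ∼-Reasoning
      cofactor : Vec ℕ m
      cofactor = suc k ⊡ χ S
      shifted-term : Vec Bool m → Pol
      shifted-term T = mono (cofactor ⊞ χ T)
      shifted-σ : Pol
      shifted-σ = sumP (List.map shifted-term subsets-of-size)
      shifted-σ∈⟨G⟩ : ⟨G⟩ shifted-σ
      shifted-σ∈⟨G⟩ = ⟨G⟩-resp-≈ₚ (mono-⊗-sum cofactor χ subsets-of-size)
                                  (generator-multiple σ∈G (mono cofactor))
      unique : Unique subsets-of-size
      unique = Unique.filter⁺ size-l? (allSubsets-unique m)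
      S∈subsets : S ∈ subsets-of-size
      S∈subsets = ∈-filter⁺ size-l? (allSubsets-complete m S) ∣S∣≡l
      others : ∀ T → T ∈ subsets-of-size → T ≢ S → ⟨G⟩ (shifted-term T)
      others T T∈subsets = other-summand ∣S∣≡l (proj₂ (∈-filter⁻ size-l? {xs = allSubsets m} T∈subsets))

mainTheorem1 : ∀ {c ℓ : Level} (F : Field c ℓ) (q : ℕ) → 2 ≤ q → IsPrimePower q → HasCard F q →
    (m : ℕ) → 2 ≤ m → (l : ℕ) → 1 ≤ l → l ≤ m ∸ 1 →
    let open Poly (Field.commutativeRing F) m in
    ∀ g → 𝓜 l g →
    InIdeal (λ h → 𝓜 (Data.Nat.suc l) h ⊎ (h ≡ σ l) ⊎ 𝓔 q h) g
-- For g = y^S with |S| = l: (y^S)^q lies in the ideal by the computation with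
-- σ_l, and (y^S)^q ≡ y^S modulo the field equations.
mainTheorem1 {c} F q@(suc (suc k)) (s≤s (s≤s _)) _ _ m _ l _ _ _ (S , ∣S∣≡l , ≡.refl) =
  ⟨G⟩-resp-∼ {mono (q ⊡ χ S)} (σ-multiple S ∣S∣≡l) (subset-power-reduction S)
  where
  open Poly (Field.commutativeRing F) m
  open Polynomials (Field.commutativeRing F) m
  G : Pol → Set c
  G h = 𝓜 (suc l) h ⊎ (h ≡ σ l) ⊎ 𝓔 q h
  open Ideal G
  open FieldEquations G q (inj₂ ∘ inj₂)
  open ElementarySymmetric G l k inj₁ (inj₂ (inj₁ ≡.refl))
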